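{- For every constant specification $\mathcal{CS}$ for $\mathsf{J}(\mu)$, the logic $\mathsf{J}(\mu)_{\mathcal{CS}}$ is consistent.
   Context: Terms of $\mathsf{J}(\mu)$: $t::= x_i\mid c_i\mid t\cdot t\mid t+t$ (justification variables $x_i$, constants $c_i$). Formulas: $A::= p\mid\neg A\mid A\wedge A\mid t:A\mid\mu p.A$, where in $\mu p.A$ the formula $A$ is $p$-positive (every free occurrence of $p$ in $A$ is within the scope of an even number of negations); $\vee,\rightarrow,\leftrightarrow$ are defined as usual and $\bot$ is defined as $B\wedge\neg B$ for some fixed formula $B$. $\mathsf{J}(\mu)$ has axioms: all propositional tautologies; $s:A\rightarrow(s+t):A$, $s:A\rightarrow(t+s):A$; $s:(A\rightarrow B)\rightarrow(t:A\rightarrow(s\cdot t):B)$; the closure axiom $A(\mu p.A(p))\leftrightarrow\mu p.A(p)$ for $p$-positive $A$; and rules Modus Ponens, the induction rule (from $\vdash A(B)\rightarrow B$ infer $\vdash\mu p.A(p)\rightarrow B$, for $p$-positive $A$), and Iterated Axiom Necessitation ($\vdash c_{i_n}:\dots:c_{i_1}:A$ for any axiom instance $A$, constants $c_{i_j}$, $n\ge1$). A constant specification $\mathcal{CS}$ is a set of such iterated formulas, and $\mathsf{J}(\mu)_{\mathcal{CS}}$ is the logic in which Iterated Axiom Necessitation only produces members of $\mathcal{CS}$. -}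

module Defs where

open import Data.Nat using (ℕ; zero; suc; _<_)
open import Data.Nat.Properties using (_≟_)
open import Data.Bool using (Bool; true; false; not; _∧_)
open import Data.Unit using (⊤)
open import Data.Product using (_×_)
open import Relation.Nullary using (¬_; yes; no)
open import Relation.Binary.PropositionalEquality using (_≡_; _≢_)

data Tm : Set where
  jvar  : ℕ → Tm
  jcon  : ℕ → Tm
  _·_   : Tm → Tm → Tm
  _⊕_   : Tm → Tm → Tm

-- Formulas, locally nameless: free propositional variables are 'atom i',
-- variables bound by μ are de Bruijn indices 'bvar n'.
--   A ::= p | ¬A | A ∧ A | t:A | μp.A

data Fm : Set where
  atom : ℕ → Fm
  bvar : ℕ → Fm
  ~_   : Fm → Fm
  _&_  : Fm → Fm → Fm
  _∶_  : Tm → Fm → Fm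
  μ    : Fm → Fm            -- μ p. A, with p = bvar 0 inside the body

infixr 6 _∶_
infix 8 ~_
infixr 7 _&_
infixr 4 _⇒_
infix 3 _⇔_

_⇒_ : Fm → Fm → Fm
A ⇒ B = ~ (A & ~ B)

_⇔_ : Fm → Fm → Fm
A ⇔ B = (A ⇒ B) & (B ⇒ A)

Falsum : Fm
Falsum = atom 0 & ~ atom 0

-- Substitution of a (locally closed) formula for the bound variable of level k:
-- 'openAt 0 B A' is A(B) when μp.A(p) is 'μ A'.
openAt : ℕ → Fm → Fm → Fm
openAt k B (atom i) = atom i
openAt k B (bvar n) with n ≟ k
... | yes _ = B
... | no  _ = bvar n
openAt k B (~ A) = ~ openAt k B A
openAt k B (A & C) = openAt k B A & openAt k B C
openAt k B (t ∶ A) = t ∶ openAt k B A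
openAt k B (μ A) = μ (openAt (suc k) B A)

inst : Fm → Fm → Fm
inst A B = openAt 0 B A

mutual
  Pos : ℕ → Fm → Set
  Pos k (atom _) = ⊤
  Pos k (bvar _) = ⊤
  Pos k (~ A) = Neg k A
  Pos k (A & C) = Pos k A × Pos k C
  Pos k (t ∶ A) = Pos k A
  Pos k (μ A) = Pos (suc k) A

  Neg : ℕ → Fm → Set
  Neg k (atom _) = ⊤
  Neg k (bvar n) = n ≢ k
  Neg k (~ A) = Pos k A
  Neg k (A & C) = Neg k A × Neg k C
  Neg k (t ∶ A) = Neg k A
  Neg k (μ A) = Neg (suc k) A

LC : ℕ → Fm → Set
LC k (atom _) = ⊤
LC k (bvar n) = n < k
LC k (~ A) = LC k A
LC k (A & C) = LC k A × LC k C
LC k (t ∶ A) = LC k A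
LC k (μ A) = LC (suc k) A

PosMu : Fm → Set
PosMu (atom _) = ⊤
PosMu (bvar _) = ⊤
PosMu (~ A) = PosMu A
PosMu (A & C) = PosMu A × PosMu C
PosMu (t ∶ A) = PosMu A
PosMu (μ A) = Pos 0 A × PosMu A

WF : Fm → Set
WF A = LC 0 A × PosMu A

-- Propositional tautologies: true under every Boolean valuation of the
-- non-Boolean (prime) subformulas.

eval : (Fm → Bool) → Fm → Bool
eval v (~ A) = not (eval v A)
eval v (A & C) = eval v A ∧ eval v C
eval v A = v A

Tautology : Fm → Set
Tautology A = (v : Fm → Bool) → eval v A ≡ true

data Axiom : Fm → Set where
  taut    : ∀ {A} → WF A → Tautology A → Axiom A
  sumL    : ∀ {A} s t → WF A → Axiom ((s ∶ A) ⇒ ((s ⊕ t) ∶ A))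
  sumR    : ∀ {A} s t → WF A → Axiom ((s ∶ A) ⇒ ((t ⊕ s) ∶ A))
  app     : ∀ {A B} s t → WF A → WF B →
            Axiom ((s ∶ (A ⇒ B)) ⇒ ((t ∶ A) ⇒ ((s · t) ∶ B)))
  closure : ∀ {A} → WF (μ A) → Axiom (inst A (μ A) ⇔ μ A)

data IterNec : Fm → Set where
  base : ∀ {A} i → Axiom A → IterNec (jcon i ∶ A)
  step : ∀ {F} i → IterNec F → IterNec (jcon i ∶ F)

record ConstSpec : Set₁ where
  field
    CS    : Fm → Set
    CS-ok : ∀ {F} → CS F → IterNec F
open ConstSpec public

data _⊢_ (𝒞 : ConstSpec) : Fm → Set where
  ax   : ∀ {A} → Axiom A → 𝒞 ⊢ A
  mp   : ∀ {A B} → 𝒞 ⊢ (A ⇒ B) → 𝒞 ⊢ A → 𝒞 ⊢ B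
  ind  : ∀ {A B} → WF (μ A) → WF B →
         𝒞 ⊢ (inst A B ⇒ B) → 𝒞 ⊢ (μ A ⇒ B)
  cs   : ∀ {F} → CS 𝒞 F → 𝒞 ⊢ F

infix 4 _⊢_

Consistent : ConstSpec → Set
Consistent 𝒞 = ¬ (𝒞 ⊢ Falsum)

module Submission where

-- Formulas are interpreted in Bool under an environment for the
-- μ-bound variables: atoms are false, every justification assertion
-- t : A is true, ¬ and ∧ are classical, and μp.A(p) denotes f false,
-- where f x is the value of A(p) with p set to x.  For p-positive A
-- the map f is monotone, and on the two-element lattice f false is
-- then the least fixed point of f; this is exactly what the closure
-- axiom and the induction rule require.
--
-- As ⊥ = p₀ ∧ ¬p₀ is false,
-- nothing derives it.

open import Defs
open import Data.Nat using (ℕ; zero; suc; _<_; s≤s)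
open import Data.Nat.Properties using (_≟_; suc-injective)
open import Data.Bool using (Bool; true; false; not; _∧_; _≤_; b≤b; f≤t)
open import Data.Bool.Properties using (≤-minimum; ≤-reflexive; ≤-trans)
open import Data.Product using (_,_)
open import Data.Empty using (⊥-elim)
open import Relation.Nullary using (yes; no)
open import Relation.Binary.PropositionalEquality
  using (_≡_; _≢_; refl; sym; trans; cong; cong₂; subst; module ≡-Reasoning)

not-antitone : ∀ {a b} → a ≤ b → not b ≤ not a
not-antitone f≤t = f≤t
not-antitone b≤b = b≤b

∧-monotone : ∀ {a b c d} → a ≤ b → c ≤ d → a ∧ c ≤ b ∧ d
∧-monotone {false} _   _ = ≤-minimum _
∧-monotone {true}  b≤b q = q

⇒-true→≤ : ∀ a b → not (a ∧ not b) ≡ true → a ≤ b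
⇒-true→≤ false b _ = ≤-minimum b
⇒-true→≤ true true _ = b≤b

≤→⇒-true : ∀ {a b} → a ≤ b → not (a ∧ not b) ≡ true
≤→⇒-true {false} _ = refl
≤→⇒-true {true} b≤b = refl

≤-true : ∀ {a b} → a ≤ b → a ≡ true → b ≡ true
≤-true b≤b a≡true = a≡true

Monotone : (Bool → Bool) → Set
Monotone f = ∀ {x y} → x ≤ y → f x ≤ f y

-- f false is a fixed point: if f false = true, then true ≤ f true.
lfp-fixed : ∀ f → Monotone f → f (f false) ≡ f false
lfp-fixed f mono with f false in eq | mono {false} {true} f≤t
... | false | _     = eq
... | true  | fF≤fT = ≤-true fF≤fT refl

lfp-least : ∀ f → Monotone f → ∀ b → f b ≤ b → f false ≤ b
lfp-least f mono b fb≤b = ≤-trans (mono (≤-minimum b)) fb≤b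

-- Values of the μ-bound variables by de Bruijn index (0 = innermost binder).
Env : Set
Env = ℕ → Bool

_▷_ : Env → Bool → Env
(ρ ▷ x) zero    = x
(ρ ▷ x) (suc n) = ρ n

_[_≔_] : Env → ℕ → Bool → Env
(ρ [ k ≔ b ]) n with n ≟ k
... | yes _ = b
... | no  _ = ρ n

_≗_ : Env → Env → Set
ρ ≗ σ = ∀ n → ρ n ≡ σ n

⟦_⟧ : Fm → Env → Bool
⟦ atom _ ⟧ ρ = false
⟦ bvar n ⟧ ρ = ρ n
⟦ ~ A ⟧ ρ    = not (⟦ A ⟧ ρ)
⟦ A & C ⟧ ρ  = ⟦ A ⟧ ρ ∧ ⟦ C ⟧ ρ
⟦ _ ∶ _ ⟧ ρ  = true
⟦ μ A ⟧ ρ    = ⟦ A ⟧ (ρ ▷ false)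

▷-cong : ∀ {ρ σ} x → ρ ≗ σ → (ρ ▷ x) ≗ (σ ▷ x)
▷-cong x e zero    = refl
▷-cong x e (suc n) = e n

⟦⟧-cong : ∀ A {ρ σ} → ρ ≗ σ → ⟦ A ⟧ ρ ≡ ⟦ A ⟧ σ
⟦⟧-cong (atom _) e = refl
⟦⟧-cong (bvar n) e = e n
⟦⟧-cong (~ A)    e = cong not (⟦⟧-cong A e)
⟦⟧-cong (A & C)  e = cong₂ _∧_ (⟦⟧-cong A e) (⟦⟧-cong C e)
⟦⟧-cong (_ ∶ _)  e = refl
⟦⟧-cong (μ A)    e = ⟦⟧-cong A (▷-cong false e)

⟦⟧-local : ∀ A k {ρ σ} → LC k A → (∀ n → n < k → ρ n ≡ σ n) → ⟦ A ⟧ ρ ≡ ⟦ A ⟧ σ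
⟦⟧-local (atom _) k _         e = refl
⟦⟧-local (bvar n) k n<k       e = e n n<k
⟦⟧-local (~ A)    k lc        e = cong not (⟦⟧-local A k lc e)
⟦⟧-local (A & C)  k (lA , lC) e = cong₂ _∧_ (⟦⟧-local A k lA e) (⟦⟧-local C k lC e)
⟦⟧-local (_ ∶ _)  k _         e = refl
⟦⟧-local (μ A)    k {ρ} {σ} lc e = ⟦⟧-local A (suc k) lc agree
  where
  agree : ∀ n → n < suc k → (ρ ▷ false) n ≡ (σ ▷ false) n
  agree zero    _       = refl
  agree (suc n) (s≤s p) = e n p

⟦⟧-closed : ∀ B → LC 0 B → ∀ ρ σ → ⟦ B ⟧ ρ ≡ ⟦ B ⟧ σ
⟦⟧-closed B lc ρ σ = ⟦⟧-local B 0 lc (λ _ ())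

▷-≔ : ∀ ρ x k b → ((ρ ▷ x) [ suc k ≔ b ]) ≗ ((ρ [ k ≔ b ]) ▷ x)
▷-≔ ρ x k b zero = refl
▷-≔ ρ x k b (suc n) with suc n ≟ suc k | n ≟ k
... | yes _  | yes _  = refl
... | no _   | no _   = refl
... | yes eq | no ne  = ⊥-elim (ne (suc-injective eq))
... | no ne  | yes eq = ⊥-elim (ne (cong suc eq))

⟦⟧-openAt : ∀ B b → (∀ ρ → ⟦ B ⟧ ρ ≡ b) →
            ∀ A k ρ → ⟦ openAt k B A ⟧ ρ ≡ ⟦ A ⟧ (ρ [ k ≔ b ])
⟦⟧-openAt B b const (atom _) k ρ = refl
⟦⟧-openAt B b const (bvar n) k ρ with n ≟ k
... | yes _ = const ρ
... | no  _ = refl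
⟦⟧-openAt B b const (~ A) k ρ = cong not (⟦⟧-openAt B b const A k ρ)
⟦⟧-openAt B b const (A & C) k ρ =
  cong₂ _∧_ (⟦⟧-openAt B b const A k ρ) (⟦⟧-openAt B b const C k ρ)
⟦⟧-openAt B b const (_ ∶ _) k ρ = refl
⟦⟧-openAt B b const (μ A) k ρ =
  trans (⟦⟧-openAt B b const A (suc k) (ρ ▷ false)) (⟦⟧-cong A (▷-≔ ρ false k b))

record RaisedAt (k : ℕ) (ρ σ : Env) : Set where
  field
    at        : ρ k ≤ σ k
    elsewhere : ∀ n → n ≢ k → ρ n ≡ σ n
open RaisedAt

▷-raisedAt : ∀ {k ρ σ} x → RaisedAt k ρ σ → RaisedAt (suc k) (ρ ▷ x) (σ ▷ x)
▷-raisedAt x r .at                  = at r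
▷-raisedAt x r .elsewhere zero    _  = refl
▷-raisedAt x r .elsewhere (suc n) ne = elsewhere r n (λ n≡k → ne (cong suc n≡k))

mutual
  ⟦⟧-monotone : ∀ A k {ρ σ} → Pos k A → RaisedAt k ρ σ → ⟦ A ⟧ ρ ≤ ⟦ A ⟧ σ
  ⟦⟧-monotone (atom _) k _         r = b≤b
  ⟦⟧-monotone (bvar n) k _         r with n ≟ k
  ... | yes refl = at r
  ... | no  n≢k  = ≤-reflexive (elsewhere r n n≢k)
  ⟦⟧-monotone (~ A)    k neg       r = not-antitone (⟦⟧-antitone A k neg r)
  ⟦⟧-monotone (A & C)  k (pA , pC) r =
    ∧-monotone (⟦⟧-monotone A k pA r) (⟦⟧-monotone C k pC r)
  ⟦⟧-monotone (_ ∶ _)  k _         r = b≤b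
  ⟦⟧-monotone (μ A)    k pos       r = ⟦⟧-monotone A (suc k) pos (▷-raisedAt false r)

  ⟦⟧-antitone : ∀ A k {ρ σ} → Neg k A → RaisedAt k ρ σ → ⟦ A ⟧ σ ≤ ⟦ A ⟧ ρ
  ⟦⟧-antitone (atom _) k _         r = b≤b
  ⟦⟧-antitone (bvar n) k n≢k       r = ≤-reflexive (sym (elsewhere r n n≢k))
  ⟦⟧-antitone (~ A)    k pos       r = not-antitone (⟦⟧-monotone A k pos r)
  ⟦⟧-antitone (A & C)  k (nA , nC) r =
    ∧-monotone (⟦⟧-antitone A k nA r) (⟦⟧-antitone C k nC r)
  ⟦⟧-antitone (_ ∶ _)  k _         r = b≤b
  ⟦⟧-antitone (μ A)    k neg       r = ⟦⟧-antitone A (suc k) neg (▷-raisedAt false r)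

ρ₀ : Env
ρ₀ _ = false

value : Fm → Bool
value A = ⟦ A ⟧ ρ₀

body : Fm → Bool → Bool
body A x = ⟦ A ⟧ (ρ₀ ▷ x)

body-monotone : ∀ A → Pos 0 A → Monotone (body A)
body-monotone A pos {x} {y} x≤y = ⟦⟧-monotone A 0 pos raised
  where
  raised : RaisedAt 0 (ρ₀ ▷ x) (ρ₀ ▷ y)
  raised .at                  = x≤y
  raised .elsewhere zero    ne = ⊥-elim (ne refl)
  raised .elsewhere (suc n) _  = refl

ρ₀-≔ : ∀ b → (ρ₀ [ 0 ≔ b ]) ≗ (ρ₀ ▷ b)
ρ₀-≔ b zero    = refl
ρ₀-≔ b (suc n) = refl

value-inst : ∀ A B → LC 0 B → value (inst A B) ≡ body A (value B)
value-inst A B lc = begin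
  ⟦ openAt 0 B A ⟧ ρ₀          ≡⟨ ⟦⟧-openAt B (value B) (λ ρ → ⟦⟧-closed B lc ρ ρ₀) A 0 ρ₀ ⟩
  ⟦ A ⟧ (ρ₀ [ 0 ≔ value B ])   ≡⟨ ⟦⟧-cong A (ρ₀-≔ (value B)) ⟩
  body A (value B)             ∎
  where open ≡-Reasoning

eval-value : ∀ A → eval value A ≡ value A
eval-value (atom _) = refl
eval-value (bvar _) = refl
eval-value (~ A)    = cong not (eval-value A)
eval-value (A & C)  = cong₂ _∧_ (eval-value A) (eval-value C)
eval-value (_ ∶ _)  = refl
eval-value (μ _)    = refl

⇔-true : ∀ {a b} → a ≡ b → not (a ∧ not b) ∧ not (b ∧ not a) ≡ true
⇔-true {a} refl = cong₂ _∧_ (≤→⇒-true {a} b≤b) (≤→⇒-true {a} b≤b)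

closure-valid : ∀ A → WF (μ A) → value (inst A (μ A) ⇔ μ A) ≡ true
closure-valid A (lc , pos , _) = ⇔-true (begin
  value (inst A (μ A))        ≡⟨ value-inst A (μ A) lc ⟩
  body A (body A false)       ≡⟨ lfp-fixed (body A) (body-monotone A pos) ⟩
  value (μ A)                 ∎)
  where open ≡-Reasoning

-- The induction rule preserves truth: B is a prefixed point of body A.
induction-valid : ∀ A B → WF (μ A) → LC 0 B →
                  value (inst A B ⇒ B) ≡ true → value (μ A ⇒ B) ≡ true
induction-valid A B (_ , pos , _) lcB premise =
  ≤→⇒-true (lfp-least (body A) (body-monotone A pos) (value B) prefixed)
  where
  prefixed : body A (value B) ≤ value B
  prefixed = subst (_≤ value B) (value-inst A B lcB)
                   (⇒-true→≤ (value (inst A B)) (value B) premise)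

sound : ∀ {𝒞 F} → 𝒞 ⊢ F → value F ≡ true
sound (ax (taut {A} _ tautology))  = trans (sym (eval-value A)) (tautology value)
sound (ax (sumL _ _ _))            = refl
sound (ax (sumR _ _ _))            = refl
sound (ax (app _ _ _ _))           = refl
sound (ax (closure {A} wf))        = closure-valid A wf
sound (mp {A} {B} d e)             = ≤-true (⇒-true→≤ (value A) (value B) (sound d)) (sound e)
sound (ind {A} {B} wf (lcB , _) d) = induction-valid A B wf lcB (sound d)
-- members of CS have the form c : F, which is true
sound {𝒞} (cs F∈CS) with CS-ok 𝒞 F∈CS
... | base _ _ = refl
... | step _ _ = refl

-- Falsum = p₀ ∧ ¬p₀ has value false, so it is not derivable.
corollary2 : (𝒞 : ConstSpec) → Consistent 𝒞
corollary2 𝒞 ⊢⊥ with sound ⊢⊥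
... | ()
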